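{- Let $\mathcal F\subset\binom{[n]}{k}$ be almost intersecting and let $\ell(\mathcal F)$ be the number of pairs in its canonical partition. Then $\ell(\mathcal F)\le\binom{2k-1}{k-1}$.
   Context: A family is intersecting if any two of its members intersect; $\mathcal F$ is almost intersecting if it is not intersecting but each $F\in\mathcal F$ is disjoint from at most one member of $\mathcal F$. The canonical partition of an almost intersecting $\mathcal F$ is the unique partition $\mathcal F=\mathcal F_0\sqcup\mathcal P_1\sqcup\dots\sqcup\mathcal P_\ell$ with $\mathcal F_0$ intersecting (possibly empty) and each $\mathcal P_i=\{P_i,Q_i\}$ a pair of disjoint sets; $\ell(\mathcal F)=\ell$. -}

module Defs where

open import Data.Nat using (ℕ)
open import Data.Fin.Subset using (Subset; _∩_; Empty; ∣_∣)
open import Data.List using (List; []; _∷_; _++_; concatMap; length)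
open import Data.List.Membership.Propositional using (_∈_)
open import Data.List.Relation.Unary.All using (All)
open import Data.List.Relation.Unary.Unique.Propositional using (Unique)
open import Data.List.Relation.Binary.Permutation.Propositional using (_↭_)
open import Data.Product using (_×_; _,_; Σ)
open import Relation.Binary.PropositionalEquality using (_≡_; _≢_)
open import Relation.Nullary using (¬_)

-- A family of subsets of [n] is represented by a duplicate-free list.
Family : ℕ → Set
Family n = List (Subset n)

Disjoint : ∀ {n} → Subset n → Subset n → Set
Disjoint A B = Empty (A ∩ B)

IsKUniformFamily : ∀ {n} → ℕ → Family n → Set
IsKUniformFamily k 𝓕 = Unique 𝓕 × All (λ A → ∣ A ∣ ≡ k) 𝓕

Intersecting : ∀ {n} → Family n → Set
Intersecting 𝓕 = ∀ {A B} → A ∈ 𝓕 → B ∈ 𝓕 → A ≢ B → ¬ Disjoint A B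

AlmostIntersecting : ∀ {n} → Family n → Set
AlmostIntersecting 𝓕 =
  ¬ Intersecting 𝓕 ×
  (∀ {F G H} → F ∈ 𝓕 → G ∈ 𝓕 → H ∈ 𝓕 →
     Disjoint F G → Disjoint F H → G ≡ H)

pairsToList : ∀ {n} → List (Subset n × Subset n) → Family n
pairsToList = concatMap (λ { (P , Q) → P ∷ Q ∷ [] })

-- A canonical partition 𝓕 = 𝓕₀ ⊔ 𝓟₁ ⊔ … ⊔ 𝓟_ℓ : 𝓕₀ intersecting,
-- each 𝓟ᵢ = {Pᵢ , Qᵢ} a pair of disjoint sets.  (It is unique when 𝓕
-- is almost intersecting; ℓ = number of pairs.)
record CanonicalPartition {n} (𝓕 : Family n) : Set where
  field
    𝓕₀        : Family n
    pairs     : List (Subset n × Subset n)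
    partition : 𝓕 ↭ (𝓕₀ ++ pairsToList pairs)
    𝓕₀-intersecting : Intersecting 𝓕₀
    pairs-disjoint  : All (λ { (P , Q) → Disjoint P Q }) pairs

  ℓ : ℕ
  ℓ = length pairs

-- Doubling each pair {P, Q} of the canonical partition into (P, Q) and (Q, P) gives 2ℓ pairs
-- (Aᵢ, Bᵢ) of k-sets with Aᵢ ∩ Bᵢ = ∅ and Aᵢ ∩ Bⱼ ≠ ∅ for i ≠ j: if Aᵢ and Bⱼ were disjoint,
-- Bⱼ would be disjoint from the two distinct members Aᵢ and Aⱼ. Bollobás's theorem then gives
-- 2ℓ ≤ C(2k, k) = 2 C(2k − 1, k − 1).
--
-- Bollobás's inequality Σᵢ 1 / C(aᵢ + bᵢ, aᵢ) ≤ 1 is proved, multiplied by M!, by averaging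
-- over the points x of a ground set U: dropping the pairs with x ∈ Aᵢ and deleting x from the
-- remaining Bᵢ leaves such a system on U − x, and averaged over x every pair keeps exactly its
-- weight w(a, b), because b · w(a, b − 1) = (a + b) · w(a, b). The induction bottoms out at
-- systems of at most one pair; with two or more pairs every Bᵢ meets some Aⱼ, so is nonempty.

module Submission where

open import Defs
open import Data.Nat using (ℕ; zero; suc; _+_; _*_; _∸_; _≤_; _<_; z≤n; s≤s; NonZero; >-nonZero; _!)
open import Data.Nat.Properties
open import Data.Nat.Combinatorics
  using (_C_; nCk≡n!/k![n-k]!; k![n∸k]!∣n!; nCk≡nC[n∸k]; nCk+nC[k+1]≡[n+1]C[k+1])
open import Data.Nat.DivMod using (_/_; m/n*n≡m)
open import Data.Nat.Divisibility using (_∣_; ∣⇒≤)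
open import Data.Nat.Tactic.RingSolver using (solve-∀)
open import Data.Fin using (Fin; zero; suc)
open import Data.Fin.Subset
  using (Subset; inside; outside; ∣_∣; _∈_; _∉_; _⊆_; _-_; _─_; Nonempty; ⊤)
open import Data.Fin.Subset.Properties
  using (_∈?_; nonempty?; x∈p∩q⁺; x∈p∩q⁻; p─⊥≡p; p─q⊆p; drop-∷-⊆; x∉⁅y⁆⇒x≢y;
         x∈p∧x≢y⇒x∈p-y; x∈p⇒∣p-x∣<∣p∣; ∣p─q∣≤∣p∣; ⊆⊤)
open import Data.Vec using ([]; _∷_; here; there)
open import Data.Product using (_×_; _,_; proj₁; proj₂)
open import Function using (_∘_)
open import Data.List using (List; []; _∷_; _++_; map; length)
open import Data.List.Membership.Propositional using () renaming (_∈_ to _∈ˡ_)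
open import Data.List.Membership.Propositional.Properties using (∈-++⁺ʳ)
open import Data.List.Relation.Unary.Unique.Propositional using (Unique)
open import Data.List.Relation.Binary.Permutation.Propositional using (↭-sym; ↭⇒↭ₛ)
open import Data.List.Relation.Binary.Permutation.Propositional.Properties using (∈-resp-↭)
open import Data.List.Relation.Binary.Permutation.Setoid.Properties using (Unique-resp-↭)
open import Data.List.Relation.Unary.All using (All; []; _∷_)
import Data.List.Relation.Unary.All as All
open import Induction.WellFounded using (Acc; acc)
open import Data.Nat.Induction using (<-wellFounded)
open import Data.List.Relation.Unary.AllPairs using (AllPairs; []; _∷_)
import Data.List.Relation.Unary.AllPairs.Properties as AllPairs
open import Data.Nat.ListAction using (sum)
open import Data.Bool using (if_then_else_)
import Algebra.Properties.CommutativeSemigroup as CommSemigroupProperties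
open import Relation.Nullary using (¬_; does; yes; no; contradiction)
open import Relation.Nullary.Decidable using (decidable-stable)
open import Relation.Binary.PropositionalEquality

private variable
  n a b : ℕ
  x : Fin n
  A B U : Subset n

ascFactorial : ℕ → ℕ → ℕ
ascFactorial s zero    = 1
ascFactorial s (suc d) = suc s * ascFactorial (suc s) d

!*ascFactorial≡[+]! : ∀ s d → s ! * ascFactorial s d ≡ (s + d) !
!*ascFactorial≡[+]! s zero    = trans (*-identityʳ (s !)) (cong _! (sym (+-identityʳ s)))
!*ascFactorial≡[+]! s (suc d) = begin
  s ! * (suc s * ascFactorial (suc s) d) ≡⟨ *-assoc (s !) (suc s) _ ⟨
  s ! * suc s * ascFactorial (suc s) d   ≡⟨ cong (_* ascFactorial (suc s) d) (*-comm (s !) _) ⟩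
  suc s ! * ascFactorial (suc s) d       ≡⟨ !*ascFactorial≡[+]! (suc s) d ⟩
  (suc s + d) !                          ≡⟨ cong _! (+-suc s d) ⟨
  (s + suc d) !                          ∎
  where open ≡-Reasoning

[a+b]Ca*[a!*b!]≡[a+b]! : ∀ a b → ((a + b) C a) * (a ! * b !) ≡ (a + b) !
[a+b]Ca*[a!*b!]≡[a+b]! a b = begin
  ((a + b) C a) * (a ! * b !)
    ≡⟨ cong (λ c → ((a + b) C a) * (a ! * c !)) (m+n∸m≡n a b) ⟨
  ((a + b) C a) * (a ! * (a + b ∸ a) !)
    ≡⟨ cong (_* (a ! * (a + b ∸ a) !)) (nCk≡n!/k![n-k]! a≤a+b) ⟩
  (a + b) ! / (a ! * (a + b ∸ a) !) * (a ! * (a + b ∸ a) !)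
    ≡⟨ m/n*n≡m (k![n∸k]!∣n! a≤a+b) ⟩
  (a + b) ! ∎
  where
  open ≡-Reasoning
  a≤a+b = m≤m+n a b
  instance _ = a !* (a + b ∸ a) !≢0

-- M! / C(a + b, a) for a + b ≤ M: the number of orderings of M points in which a given
-- a-set precedes a given disjoint b-set.
weight : ℕ → ℕ → ℕ → ℕ
weight M a b = a ! * b ! * ascFactorial (a + b) (M ∸ (a + b))

weight≤! : ∀ {M a b} → a + b ≤ M → weight M a b ≤ M !
weight≤! {M} {a} {b} a+b≤M = begin
  a ! * b ! * ascFactorial (a + b) (M ∸ (a + b)) ≤⟨ *-monoˡ-≤ _ a!*b!≤[a+b]! ⟩
  (a + b) ! * ascFactorial (a + b) (M ∸ (a + b)) ≡⟨ !*ascFactorial≡[+]! (a + b) (M ∸ (a + b)) ⟩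
  (a + b + (M ∸ (a + b))) !                      ≡⟨ cong _! (m+[n∸m]≡n a+b≤M) ⟩
  M !                                            ∎
  where
  open ≤-Reasoning
  a!*b!≤[a+b]! : a ! * b ! ≤ (a + b) !
  a!*b!≤[a+b]! = ∣⇒≤ {{(a + b) !≢0}}
    (subst (λ c → a ! * c ! ∣ (a + b) !) (m+n∸m≡n a b) (k![n∸k]!∣n! (m≤m+n a b)))

weight-suc : ∀ {M a b} → suc (a + b) ≤ M →
             suc b * weight M a b ≡ (a + suc b) * weight M a (suc b)
weight-suc {M} {a} {b} a+b<M
  rewrite +-∸-assoc 1 a+b<M | +-suc a b = rearrange (a !) (b !) b (a + b) _
  where
  rearrange : ∀ x y b s r → suc b * (x * y * (suc s * r)) ≡ suc s * (x * (y + b * y) * r)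
  rearrange = solve-∀

weight[a+b]≡a!*b! : ∀ a b → weight (a + b) a b ≡ a ! * b !
weight[a+b]≡a!*b! a b rewrite n∸n≡0 (a + b) = *-identityʳ (a ! * b !)

Disjoint⇒∉ : Disjoint A B → x ∈ A → x ∉ B
Disjoint⇒∉ A∩B=∅ x∈A x∈B = A∩B=∅ (_ , x∈p∩q⁺ (x∈A , x∈B))

∉⇒Disjoint : (∀ {x} → x ∈ A → x ∉ B) → Disjoint A B
∉⇒Disjoint {A = A} {B} A∌B (x , x∈A∩B) = let x∈A , x∈B = x∈p∩q⁻ A B x∈A∩B in A∌B x∈A x∈B

Disjoint-sym : Disjoint A B → Disjoint B A
Disjoint-sym A∩B=∅ = ∉⇒Disjoint λ x∈B x∈A → Disjoint⇒∉ A∩B=∅ x∈A x∈B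

¬Disjoint⇒Nonempty : ¬ Disjoint A B → Nonempty B
¬Disjoint⇒Nonempty {B = B} A∩B≠∅ =
  decidable-stable (nonempty? B) λ B=∅ → A∩B≠∅ (∉⇒Disjoint λ {x} _ x∈B → B=∅ (x , x∈B))

x∈p-y⇒x≢y : ∀ {y} → x ∈ A - y → x ≢ y
x∈p-y⇒x≢y x∈A-y = x∉⁅y⁆⇒x≢y (x∈p─q⇒x∉q x∈A-y)
  where
  x∈p─q⇒x∉q : ∀ {n} {x : Fin n} {p q} → x ∈ p ─ q → x ∉ q
  x∈p─q⇒x∉q {p = _ ∷ _} {_ ∷ _}      (there x∈p─q) (there x∈q) = x∈p─q⇒x∉q x∈p─q x∈q
  x∈p─q⇒x∉q {p = _ ∷ _} {inside ∷ _} ()            here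

x∉p⇒p-x≡p : x ∉ A → A - x ≡ A
x∉p⇒p-x≡p {x = zero}  {A = outside ∷ A} _   = cong (outside ∷_) (p─⊥≡p A)
x∉p⇒p-x≡p {x = zero}  {A = inside ∷ A}  x∉A = contradiction here x∉A
x∉p⇒p-x≡p {x = suc x} {A = s ∷ A}       x∉A = cong (s ∷_) (x∉p⇒p-x≡p (x∉A ∘ there))

x∈p⇒suc∣p-x∣≡∣p∣ : x ∈ A → suc ∣ A - x ∣ ≡ ∣ A ∣
x∈p⇒suc∣p-x∣≡∣p∣ {A = inside ∷ A}  here        = cong (suc ∘ ∣_∣) (p─⊥≡p A)
x∈p⇒suc∣p-x∣≡∣p∣ {A = inside ∷ A}  (there x∈A) = cong suc (x∈p⇒suc∣p-x∣≡∣p∣ x∈A)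
x∈p⇒suc∣p-x∣≡∣p∣ {A = outside ∷ A} (there x∈A) = x∈p⇒suc∣p-x∣≡∣p∣ x∈A

sumOver : Subset n → (Fin n → ℕ) → ℕ
sumOver []            f = 0
sumOver (inside  ∷ U) f = f zero + sumOver U (f ∘ suc)
sumOver (outside ∷ U) f = sumOver U (f ∘ suc)

indicator : Subset n → Fin n → ℕ
indicator A x = if does (x ∈? A) then 1 else 0

sumOver-cong : ∀ (U : Subset n) {f g} → (∀ x → f x ≡ g x) → sumOver U f ≡ sumOver U g
sumOver-cong []            f≗g = refl
sumOver-cong (inside  ∷ U) f≗g = cong₂ _+_ (f≗g zero) (sumOver-cong U (f≗g ∘ suc))
sumOver-cong (outside ∷ U) f≗g = sumOver-cong U (f≗g ∘ suc)

sumOver-mono-≤ : ∀ (U : Subset n) {f g} → (∀ {x} → x ∈ U → f x ≤ g x) →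
                 sumOver U f ≤ sumOver U g
sumOver-mono-≤ []            f≤g = z≤n
sumOver-mono-≤ (inside  ∷ U) f≤g = +-mono-≤ (f≤g here) (sumOver-mono-≤ U (f≤g ∘ there))
sumOver-mono-≤ (outside ∷ U) f≤g = sumOver-mono-≤ U (f≤g ∘ there)

sumOver-+ : ∀ (U : Subset n) f g →
            sumOver U (λ x → f x + g x) ≡ sumOver U f + sumOver U g
sumOver-+ []            f g = refl
sumOver-+ (inside  ∷ U) f g =
  trans (cong (f zero + g zero +_) (sumOver-+ U (f ∘ suc) (g ∘ suc)))
        (+-interchange (f zero) (g zero) _ _)
  where open CommSemigroupProperties +-commutativeSemigroup
          using () renaming (interchange to +-interchange)
sumOver-+ (outside ∷ U) f g = sumOver-+ U (f ∘ suc) (g ∘ suc)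

sumOver-const : ∀ (U : Subset n) c → sumOver U (λ _ → c) ≡ ∣ U ∣ * c
sumOver-const []            c = refl
sumOver-const (inside  ∷ U) c = cong (c +_) (sumOver-const U c)
sumOver-const (outside ∷ U) c = sumOver-const U c

sumOver-indicator : ∀ c → A ⊆ U → sumOver U (λ x → indicator A x * c) ≡ ∣ A ∣ * c
sumOver-indicator {A = []}          {[]}          c _   = refl
sumOver-indicator {A = inside  ∷ A} {inside  ∷ U} c A⊆U =
  cong₂ _+_ (+-identityʳ c) (sumOver-indicator c (drop-∷-⊆ A⊆U))
sumOver-indicator {A = outside ∷ A} {inside  ∷ U} c A⊆U =
  sumOver-indicator c (drop-∷-⊆ A⊆U)
sumOver-indicator {A = inside  ∷ A} {outside ∷ U} c A⊆U with () ← A⊆U here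
sumOver-indicator {A = outside ∷ A} {outside ∷ U} c A⊆U =
  sumOver-indicator c (drop-∷-⊆ A⊆U)

Pair : ℕ → Set
Pair n = Subset n × Subset n

Crossing : Pair n → Pair n → Set
Crossing (A , B) (A′ , B′) = ¬ Disjoint A B′ × ¬ Disjoint A′ B

record BollobasSystem (U : Subset n) (D : List (Pair n)) : Set where
  field
    within   : All (λ (A , B) → A ⊆ U × B ⊆ U) D
    disjoint : All (λ (A , B) → Disjoint A B) D
    crossing : AllPairs Crossing D

pairWeight : ℕ → Pair n → ℕ
pairWeight M (A , B) = weight M ∣ A ∣ ∣ B ∣

totalWeight : ℕ → List (Pair n) → ℕ
totalWeight M D = sum (map (pairWeight M) D)

restrict : Fin n → List (Pair n) → List (Pair n)
restrict x []            = []
restrict x ((A , B) ∷ D) with x ∈? A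
... | yes _ = restrict x D
... | no  _ = (A , B - x) ∷ restrict x D

module _ {x : Fin n} where

  All-restrict : ∀ {P Q : Pair n → Set} →
                 (∀ {A B} → x ∉ A → P (A , B) → Q (A , B - x)) →
                 ∀ {D} → All P D → All Q (restrict x D)
  All-restrict f {[]}          []         = []
  All-restrict f {(A , B) ∷ D} (pAB ∷ pD) with x ∈? A
  ... | yes _   = All-restrict f pD
  ... | no  x∉A = f x∉A pAB ∷ All-restrict f pD

  AllPairs-restrict : ∀ {R : Pair n → Pair n → Set} →
                      (∀ {A B A′ B′} → x ∉ A → x ∉ A′ →
                         R (A , B) (A′ , B′) → R (A , B - x) (A′ , B′ - x)) →
                      ∀ {D} → AllPairs R D → AllPairs R (restrict x D)
  AllPairs-restrict f {[]}          []         = []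
  AllPairs-restrict f {(A , B) ∷ D} (rAB ∷ rD) with x ∈? A
  ... | yes _   = AllPairs-restrict f rD
  ... | no  x∉A = All-restrict (f x∉A) rAB ∷ AllPairs-restrict f rD

restrict-BollobasSystem : ∀ {D} → BollobasSystem U D → BollobasSystem (U - x) (restrict x D)
restrict-BollobasSystem {U = U} {x = x} system = record
  { within   = All-restrict (λ x∉A (A⊆U , B⊆U) → A⊆U-x x∉A A⊆U , B-x⊆U-x B⊆U) within
  ; disjoint = All-restrict (λ _ A∩B=∅ → ∉⇒Disjoint λ y∈A y∈B-x →
                               Disjoint⇒∉ A∩B=∅ y∈A (p─q⊆p _ _ y∈B-x))
                             disjoint
  ; crossing = AllPairs-restrict (λ x∉A x∉A′ (A∩B′≠∅ , A′∩B≠∅) →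
                                    ¬Disjoint-x x∉A A∩B′≠∅ , ¬Disjoint-x x∉A′ A′∩B≠∅)
                                 crossing
  }
  where
  open BollobasSystem system
  A⊆U-x : ∀ {A} → x ∉ A → A ⊆ U → A ⊆ U - x
  A⊆U-x x∉A A⊆U y∈A = x∈p∧x≢y⇒x∈p-y (A⊆U y∈A) λ { refl → x∉A y∈A }
  B-x⊆U-x : ∀ {B} → B ⊆ U → B - x ⊆ U - x
  B-x⊆U-x B⊆U y∈B-x = x∈p∧x≢y⇒x∈p-y (B⊆U (p─q⊆p _ _ y∈B-x)) (x∈p-y⇒x≢y y∈B-x)
  ¬Disjoint-x : ∀ {A B} → x ∉ A → ¬ Disjoint A B → ¬ Disjoint A (B - x)
  ¬Disjoint-x x∉A A∩B≠∅ A∩[B-x]=∅ = A∩B≠∅ (∉⇒Disjoint λ y∈A y∈B →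
    Disjoint⇒∉ A∩[B-x]=∅ y∈A (x∈p∧x≢y⇒x∈p-y y∈B λ { refl → x∉A y∈A }))

deletedWeight : ℕ → Fin n → Pair n → ℕ
deletedWeight M x (A , B) with x ∈? A
... | yes _ = 0
... | no  _ = weight M ∣ A ∣ ∣ B - x ∣

totalWeight-restrict-∷ : ∀ M p (D : List (Pair n)) →
  totalWeight M (restrict x (p ∷ D)) ≡ deletedWeight M x p + totalWeight M (restrict x D)
totalWeight-restrict-∷ {x = x} M (A , B) D with x ∈? A
... | yes _ = refl
... | no  _ = refl

deletedWeight-pointwise : ∀ M → Disjoint A B → suc b ≡ ∣ B ∣ → ∀ x →
  let w = weight M ∣ A ∣ (suc b) in
  deletedWeight M x (A , B) + indicator A x * w + indicator B x * w
    ≡ w + indicator B x * weight M ∣ A ∣ b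
deletedWeight-pointwise {A = A} {B} {b} M A∩B=∅ ∣B∣≡ x with x ∈? A | x ∈? B
... | yes x∈A | yes x∈B = contradiction x∈B (Disjoint⇒∉ A∩B=∅ x∈A)
... | yes _   | no  _   = +-identityʳ _
... | no  _   | yes x∈B =
  trans (cong (λ c → weight M ∣ A ∣ c + 0 + (weight M ∣ A ∣ (suc b) + 0)) ∣B-x∣≡b)
        (rearrange (weight M ∣ A ∣ b) (weight M ∣ A ∣ (suc b)))
  where
  ∣B-x∣≡b : ∣ B - x ∣ ≡ b
  ∣B-x∣≡b = suc-injective (trans (x∈p⇒suc∣p-x∣≡∣p∣ x∈B) (sym ∣B∣≡))
  rearrange : ∀ u w → u + 0 + (w + 0) ≡ w + (u + 0)
  rearrange = solve-∀
... | no  _   | no  x∉B =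
  trans (+-identityʳ _)
        (cong (λ c → weight M ∣ A ∣ c + 0) (trans (cong ∣_∣ (x∉p⇒p-x≡p x∉B)) (sym ∣B∣≡)))

sumOver-deletedWeight : ∀ M → A ⊆ U → B ⊆ U → Disjoint A B → Nonempty B → ∣ A ∣ + ∣ B ∣ ≤ M →
  sumOver U (λ x → deletedWeight M x (A , B)) ≡ ∣ U ∣ * pairWeight M (A , B)
sumOver-deletedWeight {A = A} {U} {B} M A⊆U B⊆U A∩B=∅ (y , y∈B) ∣A∣+∣B∣≤M =
  trans (+-cancelʳ-≡ (∣ A ∣ * w + ∣ B ∣ * w) _ _ (begin
    sumOver U dW + (∣ A ∣ * w + ∣ B ∣ * w)
      ≡⟨ +-assoc (sumOver U dW) _ _ ⟨
    sumOver U dW + ∣ A ∣ * w + ∣ B ∣ * w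
      ≡⟨ cong₂ (λ s t → sumOver U dW + s + t) (sumOver-indicator w A⊆U) (sumOver-indicator w B⊆U) ⟨
    sumOver U dW + sumOver U (λ x → indicator A x * w) + sumOver U (λ x → indicator B x * w)
      ≡⟨ cong (_+ sumOver U (λ x → indicator B x * w)) (sumOver-+ U dW _) ⟨
    sumOver U (λ x → dW x + indicator A x * w) + sumOver U (λ x → indicator B x * w)
      ≡⟨ sumOver-+ U (λ x → dW x + indicator A x * w) _ ⟨
    sumOver U (λ x → dW x + indicator A x * w + indicator B x * w)
      ≡⟨ sumOver-cong U (deletedWeight-pointwise M A∩B=∅ ∣B∣≡) ⟩
    sumOver U (λ x → w + indicator B x * w⁻)
      ≡⟨ sumOver-+ U (λ _ → w) _ ⟩
    sumOver U (λ _ → w) + sumOver U (λ x → indicator B x * w⁻)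
      ≡⟨ cong₂ _+_ (sumOver-const U w) (sumOver-indicator w⁻ B⊆U) ⟩
    ∣ U ∣ * w + ∣ B ∣ * w⁻
      ≡⟨ cong (∣ U ∣ * w +_) ∣B∣*w⁻≡[∣A∣+∣B∣]*w ⟩
    ∣ U ∣ * w + (∣ A ∣ * w + ∣ B ∣ * w) ∎))
  (cong (λ c → ∣ U ∣ * weight M ∣ A ∣ c) ∣B∣≡)
  where
  open ≡-Reasoning
  b₀ = ∣ B - y ∣
  ∣B∣≡ : suc b₀ ≡ ∣ B ∣
  ∣B∣≡ = x∈p⇒suc∣p-x∣≡∣p∣ y∈B
  dW = λ x → deletedWeight M x (A , B)
  w  = weight M ∣ A ∣ (suc b₀)
  w⁻ = weight M ∣ A ∣ b₀
  ∣A∣+b₀<M : suc (∣ A ∣ + b₀) ≤ M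
  ∣A∣+b₀<M = subst (_≤ M) (trans (cong (∣ A ∣ +_) (sym ∣B∣≡)) (+-suc ∣ A ∣ b₀)) ∣A∣+∣B∣≤M
  ∣B∣*w⁻≡[∣A∣+∣B∣]*w : ∣ B ∣ * w⁻ ≡ ∣ A ∣ * w + ∣ B ∣ * w
  ∣B∣*w⁻≡[∣A∣+∣B∣]*w = begin
    ∣ B ∣ * w⁻            ≡⟨ cong (_* w⁻) ∣B∣≡ ⟨
    suc b₀ * w⁻            ≡⟨ weight-suc {M} {∣ A ∣} {b₀} ∣A∣+b₀<M ⟩
    (∣ A ∣ + suc b₀) * w   ≡⟨ *-distribʳ-+ w ∣ A ∣ (suc b₀) ⟩
    ∣ A ∣ * w + suc b₀ * w ≡⟨ cong (λ c → ∣ A ∣ * w + c * w) ∣B∣≡ ⟩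
    ∣ A ∣ * w + ∣ B ∣ * w ∎

sumOver-totalWeight-restrict : ∀ M {D : List (Pair n)} →
  All (λ (A , B) → A ⊆ U × B ⊆ U) D → All (λ (A , B) → Disjoint A B) D →
  All (λ (_ , B) → Nonempty B) D → All (λ (A , B) → ∣ A ∣ + ∣ B ∣ ≤ M) D →
  sumOver U (λ x → totalWeight M (restrict x D)) ≡ ∣ U ∣ * totalWeight M D
sumOver-totalWeight-restrict {U = U} M {[]} [] [] [] [] =
  trans (sumOver-const U 0) (trans (*-zeroʳ ∣ U ∣) (sym (*-zeroʳ ∣ U ∣)))
sumOver-totalWeight-restrict {U = U} M {p ∷ D}
  ((A⊆U , B⊆U) ∷ within) (A∩B=∅ ∷ disjoint) (B≠∅ ∷ nonempty) (∣A∣+∣B∣≤M ∷ bounded) = begin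
  sumOver U (λ x → totalWeight M (restrict x (p ∷ D)))
    ≡⟨ sumOver-cong U (λ _ → totalWeight-restrict-∷ M p D) ⟩
  sumOver U (λ x → deletedWeight M x p + totalWeight M (restrict x D))
    ≡⟨ sumOver-+ U _ _ ⟩
  sumOver U (λ x → deletedWeight M x p) + sumOver U (λ x → totalWeight M (restrict x D))
    ≡⟨ cong₂ _+_ (sumOver-deletedWeight M A⊆U B⊆U A∩B=∅ B≠∅ ∣A∣+∣B∣≤M)
                 (sumOver-totalWeight-restrict M within disjoint nonempty bounded) ⟩
  ∣ U ∣ * pairWeight M p + ∣ U ∣ * totalWeight M D
    ≡⟨ *-distribˡ-+ ∣ U ∣ _ _ ⟨
  ∣ U ∣ * totalWeight M (p ∷ D) ∎
  where open ≡-Reasoning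

crossing⇒Nonempty : ∀ {p q} {D : List (Pair n)} →
                    AllPairs Crossing (p ∷ q ∷ D) → All (λ (_ , B) → Nonempty B) (p ∷ q ∷ D)
crossing⇒Nonempty ((p×q ∷ p×D) ∷ _) =
  ¬Disjoint⇒Nonempty (proj₂ p×q) ∷ All.map (¬Disjoint⇒Nonempty ∘ proj₁) (p×q ∷ p×D)

bollobas : ∀ M {U : Subset n} {D} → BollobasSystem U D →
           All (λ (A , B) → ∣ A ∣ + ∣ B ∣ ≤ M) D → totalWeight M D ≤ M !
bollobas M {U} = go U (<-wellFounded ∣ U ∣)
  where
  go : ∀ U → Acc _<_ ∣ U ∣ → ∀ {D} → BollobasSystem U D →
       All (λ (A , B) → ∣ A ∣ + ∣ B ∣ ≤ M) D → totalWeight M D ≤ M !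
  go U _ {[]} _ _ = z≤n
  go U _ {(A , B) ∷ []} _ (∣A∣+∣B∣≤M ∷ []) =
    subst (_≤ M !) (sym (+-identityʳ _)) (weight≤! {M} {∣ A ∣} {∣ B ∣} ∣A∣+∣B∣≤M)
  go U (acc smaller) {D@(_ ∷ _ ∷ _)} system bounded =
    *-cancelˡ-≤ ∣ U ∣ {{U≠∅}} (begin
      ∣ U ∣ * totalWeight M D
        ≡⟨ sumOver-totalWeight-restrict M within disjoint nonempty bounded ⟨
      sumOver U (λ x → totalWeight M (restrict x D))
        ≤⟨ sumOver-mono-≤ U (λ {x} x∈U →
             go (U - x) (smaller (x∈p⇒∣p-x∣<∣p∣ x∈U))
                (restrict-BollobasSystem system) (restrict-bounded {x} bounded)) ⟩
      sumOver U (λ _ → M !)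
        ≡⟨ sumOver-const U (M !) ⟩
      ∣ U ∣ * M ! ∎)
    where
    open ≤-Reasoning
    open BollobasSystem system
    nonempty = crossing⇒Nonempty crossing
    U≠∅ : NonZero ∣ U ∣
    U≠∅ with (_ , B⊆U) ∷ _ ← within | (y , y∈B) ∷ _ ← nonempty =
      >-nonZero (≤-trans (s≤s z≤n) (x∈p⇒∣p-x∣<∣p∣ (B⊆U y∈B)))
    restrict-bounded : ∀ {x D} → All (λ (A , B) → ∣ A ∣ + ∣ B ∣ ≤ M) D →
                       All (λ (A , B) → ∣ A ∣ + ∣ B ∣ ≤ M) (restrict x D)
    restrict-bounded = All-restrict λ {A} {B} _ → ≤-trans (+-monoʳ-≤ ∣ A ∣ (∣p─q∣≤∣p∣ B _))

totalWeight-uniform : ∀ {D : List (Pair n)} → All (λ (A , B) → ∣ A ∣ ≡ a × ∣ B ∣ ≡ b) D →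
                      totalWeight (a + b) D ≡ length D * (a ! * b !)
totalWeight-uniform []                          = refl
totalWeight-uniform {a = a} {b} ((∣A∣≡a , ∣B∣≡b) ∷ sizes) =
  cong₂ _+_ (trans (cong₂ (weight (a + b)) ∣A∣≡a ∣B∣≡b) (weight[a+b]≡a!*b! a b))
            (totalWeight-uniform sizes)

bollobas-uniform : ∀ {U : Subset n} {D} → BollobasSystem U D →
                   All (λ (A , B) → ∣ A ∣ ≡ a × ∣ B ∣ ≡ b) D → length D ≤ (a + b) C a
bollobas-uniform {a = a} {b} {D = D} system sizes =
  *-cancelʳ-≤ _ _ (a ! * b !) {{a !* b !≢0}} (begin
    length D * (a ! * b !)      ≡⟨ totalWeight-uniform sizes ⟨
    totalWeight (a + b) D       ≤⟨ bollobas (a + b) system bounded ⟩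
    (a + b) !                   ≡⟨ [a+b]Ca*[a!*b!]≡[a+b]! a b ⟨
    ((a + b) C a) * (a ! * b !) ∎)
  where
  open ≤-Reasoning
  bounded = All.map (λ (∣A∣≡a , ∣B∣≡b) → ≤-reflexive (cong₂ _+_ ∣A∣≡a ∣B∣≡b)) sizes

AllPairs-++⁻ʳ : ∀ {X : Set} {R : X → X → Set} xs {ys} → AllPairs R (xs ++ ys) → AllPairs R ys
AllPairs-++⁻ʳ []       rs       = rs
AllPairs-++⁻ʳ (_ ∷ xs) (_ ∷ rs) = AllPairs-++⁻ʳ xs rs

AllPairs-mapWithAll : ∀ {X : Set} {P : X → Set} {R S : X → X → Set} →
                      (∀ {x y} → P x → P y → R x y → S x y) →
                      ∀ {xs} → All P xs → AllPairs R xs → AllPairs S xs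
AllPairs-mapWithAll f []         []         = []
AllPairs-mapWithAll f (px ∷ pxs) (rx ∷ rxs) =
  All.zipWith (λ (py , r) → f px py r) (pxs , rx) ∷ AllPairs-mapWithAll f pxs rxs

bothOrientations : List (Pair n) → List (Pair n)
bothOrientations []             = []
bothOrientations ((P , Q) ∷ ps) = (P , Q) ∷ (Q , P) ∷ bothOrientations ps

map-proj₁-bothOrientations : ∀ (ps : List (Pair n)) →
                             map proj₁ (bothOrientations ps) ≡ pairsToList ps
map-proj₁-bothOrientations []             = refl
map-proj₁-bothOrientations ((P , Q) ∷ ps) = cong (λ xs → P ∷ Q ∷ xs) (map-proj₁-bothOrientations ps)

length-bothOrientations : ∀ (ps : List (Pair n)) → length (bothOrientations ps) ≡ 2 * length ps
length-bothOrientations []       = refl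
length-bothOrientations (_ ∷ ps) =
  trans (cong (2 +_) (length-bothOrientations ps)) (cong suc (sym (+-suc (length ps) _)))

DisjointPairIn : Family n → Pair n → Set
DisjointPairIn 𝓕 (A , B) = A ∈ˡ 𝓕 × B ∈ˡ 𝓕 × Disjoint A B

All-bothOrientations : ∀ {𝓕 : Family n} {ps} → All (_∈ˡ 𝓕) (pairsToList ps) →
                       All (λ { (P , Q) → Disjoint P Q }) ps →
                       All (DisjointPairIn 𝓕) (bothOrientations ps)
All-bothOrientations {ps = []}    []                []        = []
All-bothOrientations {ps = _ ∷ _} (P∈𝓕 ∷ Q∈𝓕 ∷ ∈𝓕) (P∩Q=∅ ∷ ds) =
  (P∈𝓕 , Q∈𝓕 , P∩Q=∅) ∷ (Q∈𝓕 , P∈𝓕 , Disjoint-sym P∩Q=∅) ∷ All-bothOrientations ∈𝓕 ds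

almostIntersecting⇒Crossing : ∀ {𝓕 : Family n} → AlmostIntersecting 𝓕 → ∀ {p q} →
  DisjointPairIn 𝓕 p → DisjointPairIn 𝓕 q → proj₁ p ≢ proj₁ q → Crossing p q
almostIntersecting⇒Crossing (_ , uniquePartner) (A∈𝓕 , B∈𝓕 , A∩B=∅) (A′∈𝓕 , B′∈𝓕 , A′∩B′=∅) A≢A′ =
  (λ A∩B′=∅ → A≢A′ (uniquePartner B′∈𝓕 A∈𝓕 A′∈𝓕 (Disjoint-sym A∩B′=∅) (Disjoint-sym A′∩B′=∅))) ,
  (λ A′∩B=∅ → A≢A′ (uniquePartner B∈𝓕 A∈𝓕 A′∈𝓕 (Disjoint-sym A∩B=∅) (Disjoint-sym A′∩B=∅)))

twice-ℓ≤[k+k]Ck : ∀ {k} {𝓕 : Family n} → IsKUniformFamily k 𝓕 → AlmostIntersecting 𝓕 →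
                  (π : CanonicalPartition 𝓕) → 2 * CanonicalPartition.ℓ π ≤ (k + k) C k
twice-ℓ≤[k+k]Ck {n} {k} {𝓕} (𝓕-unique , 𝓕-uniform) 𝓕-almost π = begin
  2 * ℓ       ≡⟨ length-bothOrientations pairs ⟨
  length D    ≤⟨ bollobas-uniform system sizes ⟩
  (k + k) C k ∎
  where
  open ≤-Reasoning
  open CanonicalPartition π
  D = bothOrientations pairs
  pairs∈𝓕 : All (_∈ˡ 𝓕) (pairsToList pairs)
  pairs∈𝓕 = All.tabulate λ P∈pairs → ∈-resp-↭ (↭-sym partition) (∈-++⁺ʳ 𝓕₀ P∈pairs)
  pairs-unique : Unique (pairsToList pairs)
  pairs-unique = AllPairs-++⁻ʳ 𝓕₀ (Unique-resp-↭ (setoid (Subset n)) (↭⇒↭ₛ partition) 𝓕-unique)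
  D-good : All (DisjointPairIn 𝓕) D
  D-good = All-bothOrientations pairs∈𝓕 pairs-disjoint
  system : BollobasSystem ⊤ D
  system = record
    { within   = All.map (λ _ → (λ {_} → ⊆⊤) , (λ {_} → ⊆⊤)) D-good
    ; disjoint = All.map (proj₂ ∘ proj₂) D-good
    ; crossing = AllPairs-mapWithAll (almostIntersecting⇒Crossing 𝓕-almost) D-good
        (AllPairs.map⁻ (subst Unique (sym (map-proj₁-bothOrientations pairs)) pairs-unique))
    }
  sizes : All (λ (A , B) → ∣ A ∣ ≡ k × ∣ B ∣ ≡ k) D
  sizes = All.map (λ (A∈𝓕 , B∈𝓕 , _) → All.lookup 𝓕-uniform A∈𝓕 , All.lookup 𝓕-uniform B∈𝓕) D-good

[k+k]Ck≡2*[2k∸1]C[k∸1] : ∀ k → .{{NonZero k}} → (k + k) C k ≡ 2 * ((2 * k ∸ 1) C (k ∸ 1))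
[k+k]Ck≡2*[2k∸1]C[k∸1] (suc j) = begin
  suc (j + suc j) C suc j          ≡⟨ nCk+nC[k+1]≡[n+1]C[k+1] (j + suc j) j ⟨
  (j + suc j) C j + (j + suc j) C suc j
    ≡⟨ cong ((j + suc j) C j +_) (trans (nCk≡nC[n∸k] (m≤n+m (suc j) j))
                                         (cong ((j + suc j) C_) (m+n∸n≡m j (suc j)))) ⟩
  (j + suc j) C j + (j + suc j) C j ≡⟨ cong ((j + suc j) C j +_) (+-identityʳ _) ⟨
  2 * ((j + suc j) C j)             ≡⟨ cong (λ m → 2 * ((j + suc m) C j)) (+-identityʳ j) ⟨
  2 * ((j + suc (j + 0)) C j)       ∎
  where open ≡-Reasoning

proposition2p1 : (n k : ℕ) (𝓕 : Family n) →
    IsKUniformFamily k 𝓕 → AlmostIntersecting 𝓕 →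
    (π : CanonicalPartition 𝓕) →
    CanonicalPartition.ℓ π ≤ (2 * k ∸ 1) C (k ∸ 1)
proposition2p1 n zero        𝓕 uniform almost π =
  ≤-trans (m≤m+n ℓ (ℓ + 0)) (twice-ℓ≤[k+k]Ck uniform almost π)
  where ℓ = CanonicalPartition.ℓ π
proposition2p1 n k@(suc _) 𝓕 uniform almost π =
  *-cancelˡ-≤ 2 (subst (2 * ℓ ≤_) ([k+k]Ck≡2*[2k∸1]C[k∸1] k) (twice-ℓ≤[k+k]Ck uniform almost π))
  where ℓ = CanonicalPartition.ℓ π
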